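{- (1) For every integer $n\ge1$, $$\left\lfloor\left(\sum_{k=n}^\infty\frac{(-1)^k}{B_{2k}^2}\right)^{ -1}\right\rfloor=\begin{cases}B_{2n}^2+B_{2n-2}^2&\text{if $n$ is even},\\ -(B_{2n}^2+B_{2n-2}^2+1)&\text{if $n$ is odd}.\end{cases}$$ (2) For every integer $n\ge2$, $$\left\lfloor\left(\sum_{k=n}^\infty\frac{(-1)^k}{B_{2k-1}^2}\right)^{ -1}\right\rfloor=\begin{cases}B_{2n-1}^2+B_{2n-3}^2&\text{if $n$ is even},\\ -(B_{2n-1}^2+B_{2n-3}^2+1)&\text{if $n$ is odd}.\end{cases}$$ (3) For every integer $n\ge1$, $$\left\lfloor\left(\sum_{k=n}^\infty\frac{(-1)^k}{B_{2k-1}B_{2k+1}}\right)^{ -1}\right\rfloor=\begin{cases}B_{2n}^2+B_{2n-2}^2-1&\text{if $n$ is even},\\ -(B_{2n}^2+B_{2n-2}^2)&\text{if $n$ is odd}.\end{cases}$$ (4) For every integer $n\ge1$, $$\left\lfloor\left(\sum_{k=n}^\infty\frac{(-1)^k}{B_{2k}B_{2k+2}}\right)^{ -1}\right\rfloor=\begin{cases}B_{2n+1}^2+B_{2n-1}^2-1&\text{if $n$ is even},\\ -(B_{2n+1}^2+B_{2n-1}^2)&\text{if $n$ is odd}.\end{cases}$$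
   Context: The balancing numbers are defined by $B_0=0$, $B_1=1$, $B_n=6B_{n-1}-B_{n-2}$ for $n\ge 2$ (only nonnegative indices are used). $\lfloor x\rfloor$ denotes the floor of a real number $x$. -}

module Defs where

open import Data.Nat using (ℕ; zero; suc; _∸_) renaming (_*_ to _*ℕ_; _≤_ to _≤ℕ_)
open import Data.Integer using (ℤ; +_; -[1+_])
open import Data.Rational using (ℚ; _/_; 0ℚ; 1ℚ; -_; _+_; _-_; _*_; ∣_∣; _<_; _≤_)
open import Data.Product using (Σ; ∃; _×_)

-- Balancing numbers: B 0 = 0, B 1 = 1, B n = 6 B (n-1) - B (n-2).
-- (The sequence is increasing, so the truncated subtraction ∸ never truncates.)
B : ℕ → ℕ
B zero = 0
B (suc zero) = 1
B (suc (suc n)) = 6 *ℕ B (suc n) ∸ B n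

-- reciprocal 1/d of a natural number as a rational (convention 1/0 := 0;
-- it is only ever applied to nonzero numbers in the statement)
recip : ℕ → ℚ
recip zero = 0ℚ
recip d@(suc _) = + 1 / d

negOnePow : ℕ → ℚ
negOnePow zero = 1ℚ
negOnePow (suc k) = - negOnePow k

-- partial sums of the tail series:  altTail t n N = Σ_{k=n}^{n+N} (-1)^k t k
altTail : (ℕ → ℚ) → ℕ → ℕ → ℚ
altTail t n zero = negOnePow n * t n
altTail t n (suc N) = altTail t n N + negOnePow (n Data.Nat.+ suc N) * t (n Data.Nat.+ suc N)

-- Real-number notions encoded via rational sequences (no reals in stdlib).
-- The sequence s is Cauchy, i.e. converges to a real number L.
Cauchy : (ℕ → ℚ) → Set
Cauchy s = ∀ (ε : ℚ) → 0ℚ < ε → ∃ λ N → ∀ i j → N ≤ℕ i → N ≤ℕ j → ∣ s i - s j ∣ < ε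

-- (for Cauchy s)  lim s > q
LimGt : (ℕ → ℚ) → ℚ → Set
LimGt s q = Σ ℚ λ ε → 0ℚ < ε × ∃ λ N → ∀ i → N ≤ℕ i → q + ε ≤ s i

-- (for Cauchy s)  lim s ≤ q
LimLe : (ℕ → ℚ) → ℚ → Set
LimLe s q = ∀ (ε : ℚ) → 0ℚ < ε → ∃ λ N → ∀ i → N ≤ℕ i → s i ≤ q + ε

-- ⌊ 1 / L ⌋ = m  where L = lim s (a real number, necessarily nonzero).
-- Unfolded: m ≤ 1/L < m+1, which for L real is equivalent to:
--   m ≥ 1  : 1/(m+1) < L ≤ 1/m
--   m = 0  : L > 1
--   m = -1 : L ≤ -1
--   m ≤ -2 : 1/(m+1) < L ≤ 1/m
FloorRecipLim : (ℕ → ℚ) → ℤ → Set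
FloorRecipLim s m = Cauchy s × bounds m
  where
  bounds : ℤ → Set
  bounds (+ zero) = LimGt s 1ℚ
  bounds (+ (suc k)) = LimGt s (+ 1 / suc (suc k)) × LimLe s (+ 1 / suc k)
  bounds -[1+ zero ] = LimLe s (- 1ℚ)
  bounds -[1+ suc k ] = LimGt s (-[1+ 0 ] / suc k) × LimLe s (-[1+ 0 ] / suc (suc k))

t₁ t₂ t₃ t₄ : ℕ → ℚ
t₁ k = recip (B (2 *ℕ k) *ℕ B (2 *ℕ k))
t₂ k = recip (B (2 *ℕ k ∸ 1) *ℕ B (2 *ℕ k ∸ 1))
t₃ k = recip (B (2 *ℕ k ∸ 1) *ℕ B (2 *ℕ k Data.Nat.+ 1))
t₄ k = recip (B (2 *ℕ k) *ℕ B (2 *ℕ k Data.Nat.+ 2))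

-- Each claim has the form ⌊1/T⌋ = ±c_n for a tail T = Σ_{k≥n} (-1)^k/d_k.  Group (-1)^n T into
-- consecutive pairs of terms: the sums of the first M pairs plus 1/(c_{n+2M}+1), resp. plus
-- 1/c_{n+2M}, are strictly increasing, resp. decreasing, in M as soon as
--   1/(c_k+1) + 1/d_{k+1} < 1/d_k + 1/(c_{k+2}+1)   and   1/d_k + 1/c_{k+2} < 1/c_k + 1/d_{k+1},
-- and both converge to (-1)^n T, so 1/(c_n+1) < (-1)^n T ≤ 1/c_n.  Here d_k = B_j² - δ (δ = 0 for
-- the squares, δ = 1 for B_{j-1}B_{j+1}) and c_k = B_j² + B_{j-2}² - δ.  Cross-multiplied, the two
-- inequalities factor as (B_{m+4}² - B_{m+2}²)·K with j = m+2 and K affine in B_{m+6}B_m with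
-- positive coefficients; the factorisation only uses Catalan's identities
-- B_{i+k}B_{i-k} = B_i² - B_k² (k = 1, 2, 3) and two sums of squares around B_{m+3}, all of which
-- follow from the Cassini identity B_{i+1}² + B_i² - 6 B_i B_{i+1} = 1.
{-# OPTIONS --safe #-}
module Submission where

open import Defs

module Reciprocals where
  open import Data.Nat as ℕ using (ℕ; zero; suc; z≤n; s≤s; NonZero)
  import Data.Nat.Properties as ℕP
  open import Data.Integer as ℤ using (+_; -[1+_]; +<+)
  open import Data.Integer.Tactic.RingSolver using (solve-∀)
  open import Data.Nat.Tactic.RingSolver using () renaming (solve to ℕsolve)
  open import Data.List using (_∷_; [])
  open import Data.Rational using (mkℚ; 0ℚ; _+_; _≤_; _<_; *<*; toℚᵘ)
  import Data.Rational.Properties as ℚP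
  import Data.Rational.Unnormalised as ℚᵘ
  import Data.Rational.Unnormalised.Properties as ℚᵘP
  open import Data.Nat.Coprimality using (1-coprimeTo)
  open import Data.Product using (∃; _,_)
  open import Relation.Binary.PropositionalEquality

  toℚᵘ-recip : ∀ n → toℚᵘ (recip (suc n)) ≡ ℚᵘ.mkℚᵘ (+ 1) n
  toℚᵘ-recip n = cong toℚᵘ (ℚP.normalize-coprime (1-coprimeTo (suc n)))

  recip-nonNeg : ∀ n → 0ℚ ≤ recip n
  recip-nonNeg zero = ℚP.≤-refl
  recip-nonNeg (suc n) = ℚP.toℚᵘ-cancel-≤ (subst (ℚᵘ._≤_ _) (sym (toℚᵘ-recip n)) (ℚᵘ.*≤* (ℤ.+≤+ z≤n)))

  recip-antitone : ∀ {m n} .{{_ : NonZero m}} → m ℕ.≤ n → recip n ≤ recip m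
  recip-antitone {suc m} {suc n} (s≤s m≤n) = ℚP.toℚᵘ-cancel-≤
    (subst₂ ℚᵘ._≤_ (sym (toℚᵘ-recip n)) (sym (toℚᵘ-recip m)) (ℚᵘ.*≤* (ℤ.+≤+ (s≤s (ℕP.+-monoˡ-≤ 0 m≤n)))))

  recip-+-< : ∀ {a b c d} .{{_ : NonZero a}} .{{_ : NonZero b}} .{{_ : NonZero c}} .{{_ : NonZero d}} →
    (+ a ℤ.+ + b) ℤ.* (+ c ℤ.* + d) ℤ.< (+ c ℤ.+ + d) ℤ.* (+ a ℤ.* + b) →
    recip a + recip b < recip c + recip d
  recip-+-< {suc a} {suc b} {suc c} {suc d} cross = ℚP.toℚᵘ-cancel-<
    (ℚᵘP.<-respˡ-≃ (ℚᵘP.≃-sym (homo a b)) (ℚᵘP.<-respʳ-≃ (ℚᵘP.≃-sym (homo c d))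
      (ℚᵘ.*<* (subst₂ ℤ._<_ (unnormalised (+ suc a) (+ suc b) (+ suc c) (+ suc d))
                            (unnormalised (+ suc c) (+ suc d) (+ suc a) (+ suc b)) cross))))
    where
    homo : ∀ m n → toℚᵘ (recip (suc m) + recip (suc n)) ℚᵘ.≃ ℚᵘ.mkℚᵘ (+ 1) m ℚᵘ.+ ℚᵘ.mkℚᵘ (+ 1) n
    homo m n = subst₂ (λ p q → toℚᵘ (recip (suc m) + recip (suc n)) ℚᵘ.≃ p ℚᵘ.+ q) (toℚᵘ-recip m) (toℚᵘ-recip n)
                 (ℚP.toℚᵘ-homo-+ (recip (suc m)) (recip (suc n)))
    unnormalised : ∀ p q r s → (p ℤ.+ q) ℤ.* (r ℤ.* s) ≡ (+ 1 ℤ.* q ℤ.+ + 1 ℤ.* p) ℤ.* (r ℤ.* s)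
    unnormalised = solve-∀

  recip-archimedean : ∀ ε → 0ℚ < ε → ∃ λ K → recip (suc K) + recip (suc K) + recip (suc K) < ε
  recip-archimedean (mkℚ (+ suc n) d _) _ = K , ℚP.toℚᵘ-cancel-<
    (ℚᵘP.<-respˡ-≃ (ℚᵘP.≃-sym thrice) (ℚᵘ.*<* (+<+ (small K d n ℕP.≤-refl))))
    where
    -- makes 3/(K+1) < 1/(d+1) ≤ ε
    K = 3 ℕ.* suc d
    e = recip (suc K)
    thrice : toℚᵘ (e + e + e) ℚᵘ.≃ ℚᵘ.mkℚᵘ (+ 1) K ℚᵘ.+ ℚᵘ.mkℚᵘ (+ 1) K ℚᵘ.+ ℚᵘ.mkℚᵘ (+ 1) K
    thrice = ℚᵘP.≃-trans (ℚP.toℚᵘ-homo-+ (e + e) e)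
      (subst (λ q → toℚᵘ (e + e) ℚᵘ.+ toℚᵘ e ℚᵘ.≃ q ℚᵘ.+ q ℚᵘ.+ q) (toℚᵘ-recip K)
        (ℚᵘP.+-congˡ (toℚᵘ e) (ℚP.toℚᵘ-homo-+ e e)))
    small : ∀ k d n → 3 ℕ.* suc d ℕ.< suc k →
      ((1 ℕ.* suc k ℕ.+ 1 ℕ.* suc k) ℕ.* suc k ℕ.+ 1 ℕ.* (suc k ℕ.* suc k)) ℕ.* suc d ℕ.< suc n ℕ.* (suc k ℕ.* suc k ℕ.* suc k)
    small k d n h = begin-strict
      ((1 ℕ.* suc k ℕ.+ 1 ℕ.* suc k) ℕ.* suc k ℕ.+ 1 ℕ.* (suc k ℕ.* suc k)) ℕ.* suc d
        ≡⟨ ℕsolve (k ∷ d ∷ []) ⟩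
      (suc k ℕ.* suc k) ℕ.* (3 ℕ.* suc d)   <⟨ ℕP.*-monoʳ-< (suc k ℕ.* suc k) h ⟩
      (suc k ℕ.* suc k) ℕ.* suc k           ≤⟨ ℕP.*-monoʳ-≤ (suc k ℕ.* suc k) (ℕP.m≤n*m (suc k) (suc n)) ⟩
      (suc k ℕ.* suc k) ℕ.* (suc n ℕ.* suc k) ≡⟨ ℕsolve (k ∷ n ∷ []) ⟩
      suc n ℕ.* (suc k ℕ.* suc k ℕ.* suc k) ∎
      where open ℕP.≤-Reasoning
  recip-archimedean (mkℚ (+ zero) _ _) (*<* (+<+ ()))
  recip-archimedean (mkℚ -[1+ _ ] _ _) (*<* ())

module AlternatingSeries where
  open import Data.Nat as ℕ using (ℕ; zero; suc; z≤n; s≤s)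
  import Data.Nat.Properties as ℕP
  open import Data.Rational using (ℚ; 0ℚ; 1ℚ; _+_; _-_; _*_; -_; _≤_; _<_; ∣_∣)
  import Data.Rational.Properties as ℚP
  open import Data.Rational.Solver using (module +-*-Solver)
  open +-*-Solver using (solve; _:+_; _:-_; :-_; _:*_; _:=_; con)
  open import Data.Product using (Σ; ∃; _×_; _,_; proj₁; proj₂)
  open import Data.Sum using (_⊎_; inj₁; inj₂)
  open import Relation.Binary.PropositionalEquality
  open Reciprocals

  1/suc : ℕ → ℚ
  1/suc j = recip (suc j)

  1/suc-nonNeg : ∀ j → 0ℚ ≤ 1/suc j
  1/suc-nonNeg j = recip-nonNeg (suc j)

  1/suc-antitone : ∀ {i j} → i ℕ.≤ j → 1/suc j ≤ 1/suc i
  1/suc-antitone i≤j = recip-antitone (s≤s i≤j)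

  HarmonicallyBounded : (ℕ → ℚ) → Set
  HarmonicallyBounded f = ∀ j → 0ℚ ≤ f j × f j ≤ 1/suc j

  LimLt : (ℕ → ℚ) → ℚ → Set
  LimLt s q = Σ ℚ λ ε → 0ℚ < ε × ∃ λ N → ∀ i → N ℕ.≤ i → s i + ε ≤ q

  double : ℕ → ℕ
  double zero = zero
  double (suc n) = suc (suc (double n))

  halve : ∀ i → ∃ λ M → i ≡ double M ⊎ i ≡ suc (double M)
  halve zero = zero , inj₁ refl
  halve (suc i) with halve i
  ... | M , inj₁ refl = M , inj₂ refl
  ... | M , inj₂ refl = suc M , inj₁ refl

  double-cancel-≤ : ∀ {K M} → double K ℕ.≤ double M → K ℕ.≤ M
  double-cancel-≤ {zero} _ = z≤n
  double-cancel-≤ {suc K} {suc M} (s≤s (s≤s le)) = s≤s (double-cancel-≤ le)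

  pos-of-double : ∀ {i M} → 1 ℕ.≤ i → i ℕ.≤ double M → 1 ℕ.≤ M
  pos-of-double {M = zero} (s≤s _) ()
  pos-of-double {M = suc M} _ _ = s≤s z≤n

  n≤double : ∀ n → n ℕ.≤ double n
  n≤double zero = z≤n
  n≤double (suc n) = s≤s (ℕP.m≤n⇒m≤1+n (n≤double n))

  negOnePow-double : ∀ M → negOnePow (double M) ≡ 1ℚ
  negOnePow-double zero = refl
  negOnePow-double (suc M) = trans (solve 1 (λ x → :- (:- x) := x) refl (negOnePow (double M))) (negOnePow-double M)

  from-steps : ∀ {A : Set} (R : A → A → Set) → (∀ {x} → R x x) → (∀ {x y z} → R x y → R y z → R x z) →
    (f : ℕ → A) → (∀ M → R (f M) (f (suc M))) → ∀ {K M} → K ℕ.≤ M → R (f K) (f M)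
  from-steps R refl' trans' f step {M = zero} z≤n = refl'
  from-steps R refl' trans' f step {K} {suc M} K≤sM with ℕP.m≤n⇒m<n∨m≡n K≤sM
  ... | inj₁ (s≤s K≤M) = trans' (from-steps R refl' trans' f step K≤M) (step M)
  ... | inj₂ refl = refl'

  p≤p+q : ∀ p {q} → 0ℚ ≤ q → p ≤ p + q
  p≤p+q p {q} 0≤q = subst (_≤ p + q) (ℚP.+-identityʳ p) (ℚP.+-monoʳ-≤ p 0≤q)

  p<q⇒0<q-p : ∀ {p q} → p < q → 0ℚ < q - p
  p<q⇒0<q-p {p} {q} p<q = subst (_< q - p) (ℚP.+-inverseʳ p) (ℚP.+-monoˡ-< (- p) p<q)

  ∣x-y∣≤hi-lo : ∀ {lo hi x y} → lo ≤ x → x ≤ hi → lo ≤ y → y ≤ hi → ∣ x - y ∣ ≤ hi - lo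
  ∣x-y∣≤hi-lo {lo} {hi} {x} {y} lo≤x x≤hi lo≤y y≤hi with ℚP.∣p∣≡p∨∣p∣≡-p (x - y)
  ... | inj₁ eq = subst (_≤ hi - lo) (sym eq) (ℚP.+-mono-≤ x≤hi (ℚP.neg-antimono-≤ lo≤y))
  ... | inj₂ eq = subst (_≤ hi - lo) (trans (solve 2 (λ x y → y :- x := :- (x :- y)) refl x y) (sym eq))
                    (ℚP.+-mono-≤ y≤hi (ℚP.neg-antimono-≤ lo≤x))

  1/suc-archimedean : ∀ ε → 0ℚ < ε → ∃ λ K → 1/suc K < ε
  1/suc-archimedean ε 0<ε =
    let (K , thrice<ε) = recip-archimedean ε 0<ε
        e = 1/suc K
    in K , ℚP.≤-<-trans (ℚP.≤-trans (p≤p+q e (1/suc-nonNeg K)) (p≤p+q (e + e) (1/suc-nonNeg K))) thrice<ε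

  module Squeeze (u ℓ h : ℕ → ℚ)
    (ℓ-step : ∀ M → ℓ (double M) + u (suc (double M)) < u (double M) + ℓ (double (suc M)))
    (h-step : ∀ M → u (double M) + h (double (suc M)) < h (double M) + u (suc (double M)))
    (u-bounded : HarmonicallyBounded u) (ℓ-bounded : HarmonicallyBounded ℓ) (h-bounded : HarmonicallyBounded h)
    where

    alt : ℕ → ℚ
    alt zero = u 0
    alt (suc N) = alt N + negOnePow (suc N) * u (suc N)

    pairs : ℕ → ℚ
    pairs zero = 0ℚ
    pairs (suc M) = pairs M + (u (double M) - u (suc (double M)))

    alt-even : ∀ M → alt (double M) ≡ pairs M + u (double M)
    alt-odd : ∀ M → alt (suc (double M)) ≡ pairs (suc M)
    alt-even zero = sym (ℚP.+-identityˡ (u 0))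
    alt-even (suc M) = begin
      alt (suc (double M)) + negOnePow (double (suc M)) * u (double (suc M))
        ≡⟨ cong₂ (λ a σ → a + σ * u (double (suc M))) (alt-odd M) (negOnePow-double (suc M)) ⟩
      pairs (suc M) + 1ℚ * u (double (suc M))
        ≡⟨ cong (pairs (suc M) +_) (ℚP.*-identityˡ (u (double (suc M)))) ⟩
      pairs (suc M) + u (double (suc M)) ∎
      where open ≡-Reasoning
    alt-odd M = begin
      alt (double M) + - negOnePow (double M) * u (suc (double M))
        ≡⟨ cong₂ (λ a σ → a + - σ * u (suc (double M))) (alt-even M) (negOnePow-double M) ⟩
      pairs M + u (double M) + - 1ℚ * u (suc (double M))
        ≡⟨ solve 3 (λ s a b → s :+ a :+ (:- con 1ℚ) :* b := s :+ (a :- b)) refl (pairs M) (u (double M)) (u (suc (double M))) ⟩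
      pairs (suc M) ∎
      where open ≡-Reasoning

    lowEnv highEnv : ℕ → ℚ
    lowEnv M = pairs M + ℓ (double M)
    highEnv M = pairs M + h (double M)

    lowEnv-step : ∀ M → lowEnv M < lowEnv (suc M)
    lowEnv-step M = subst₂ _<_
      (solve 3 (λ s a b → a :+ b :+ (s :- b) := s :+ a) refl (pairs M) (ℓ (double M)) (u (suc (double M))))
      (solve 4 (λ s b c d → c :+ d :+ (s :- b) := s :+ (c :- b) :+ d) refl
        (pairs M) (u (suc (double M))) (u (double M)) (ℓ (double (suc M))))
      (ℚP.+-monoˡ-< (pairs M - u (suc (double M))) (ℓ-step M))

    highEnv-step : ∀ M → highEnv (suc M) < highEnv M
    highEnv-step M = subst₂ _<_
      (solve 4 (λ s a b d → a :+ d :+ (s :- b) := s :+ (a :- b) :+ d) refl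
        (pairs M) (u (double M)) (u (suc (double M))) (h (double (suc M))))
      (solve 3 (λ s b c → c :+ b :+ (s :- b) := s :+ c) refl (pairs M) (u (suc (double M))) (h (double M)))
      (ℚP.+-monoˡ-< (pairs M - u (suc (double M))) (h-step M))

    lowEnv-mono : ∀ {K M} → K ℕ.≤ M → lowEnv K ≤ lowEnv M
    lowEnv-mono = from-steps _≤_ ℚP.≤-refl ℚP.≤-trans lowEnv (λ M → ℚP.<⇒≤ (lowEnv-step M))

    highEnv-antitone : ∀ {K M} → K ℕ.≤ M → highEnv M ≤ highEnv K
    highEnv-antitone = from-steps (λ p q → q ≤ p) ℚP.≤-refl (λ p q → ℚP.≤-trans q p) highEnv (λ M → ℚP.<⇒≤ (highEnv-step M))

    ℓ-small : ∀ {K M} → K ℕ.≤ double M → ℓ (double M) ≤ 1/suc K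
    ℓ-small K≤2M = ℚP.≤-trans (proj₂ (ℓ-bounded _)) (1/suc-antitone K≤2M)

    h-small : ∀ {K M} → K ℕ.≤ double M → h (double M) ≤ 1/suc K
    h-small K≤2M = ℚP.≤-trans (proj₂ (h-bounded _)) (1/suc-antitone K≤2M)

    pairs-from-lowEnv : ∀ M → lowEnv M - ℓ (double M) ≡ pairs M
    pairs-from-lowEnv M = solve 2 (λ s a → s :+ a :- a := s) refl (pairs M) (ℓ (double M))

    pairs≤highEnv : ∀ M → pairs M ≤ highEnv M
    pairs≤highEnv M = p≤p+q (pairs M) (proj₁ (h-bounded (double M)))

    pairs-above : ∀ {K M} → K ℕ.≤ double M → lowEnv M - 1/suc K ≤ pairs M
    pairs-above {K} {M} K≤2M = begin
      lowEnv M - 1/suc K       ≤⟨ ℚP.+-monoʳ-≤ (lowEnv M) (ℚP.neg-antimono-≤ (ℓ-small K≤2M)) ⟩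
      lowEnv M - ℓ (double M)  ≡⟨ pairs-from-lowEnv M ⟩
      pairs M                  ∎
      where open ℚP.≤-Reasoning

    pairs-near : ∀ {K M} → K ℕ.≤ M → pairs K - 1/suc K ≤ pairs M × pairs M ≤ pairs K + 1/suc K
    pairs-near {K} {M} K≤M =
      (begin
        pairs K - 1/suc K   ≤⟨ ℚP.+-monoˡ-≤ (- 1/suc K) (p≤p+q (pairs K) (proj₁ (ℓ-bounded (double K)))) ⟩
        lowEnv K - 1/suc K  ≤⟨ ℚP.+-monoˡ-≤ (- 1/suc K) (lowEnv-mono K≤M) ⟩
        lowEnv M - 1/suc K  ≤⟨ pairs-above (ℕP.≤-trans K≤M (n≤double M)) ⟩
        pairs M             ∎) ,
      (begin
        pairs M            ≤⟨ pairs≤highEnv M ⟩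
        highEnv M          ≤⟨ highEnv-antitone K≤M ⟩
        highEnv K          ≤⟨ ℚP.+-monoʳ-≤ (pairs K) (h-small (n≤double K)) ⟩
        pairs K + 1/suc K  ∎)
      where open ℚP.≤-Reasoning

    alt-bracket : ∀ i → ∃ λ M → i ℕ.≤ double M × pairs M ≤ alt i × alt i ≤ pairs M + 1/suc i
    alt-bracket i with halve i
    ... | M , inj₁ refl = M , ℕP.≤-refl ,
          subst (pairs M ≤_) (sym (alt-even M)) (p≤p+q (pairs M) (proj₁ (u-bounded (double M)))) ,
          subst (_≤ pairs M + 1/suc (double M)) (sym (alt-even M)) (ℚP.+-monoʳ-≤ (pairs M) (proj₂ (u-bounded _)))
    ... | M , inj₂ refl = suc M , ℕP.n≤1+n _ ,
          ℚP.≤-reflexive (sym (alt-odd M)) ,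
          subst (_≤ pairs (suc M) + 1/suc (suc (double M))) (sym (alt-odd M)) (p≤p+q (pairs (suc M)) (1/suc-nonNeg (suc (double M))))

    alt-near : ∀ {K i} → double K ℕ.≤ i → pairs K - 1/suc K ≤ alt i × alt i ≤ pairs K + (1/suc K + 1/suc K)
    alt-near {K} {i} 2K≤i =
      let (M , i≤2M , pairs≤alt , alt≤pairs) = alt-bracket i
          (lower , upper) = pairs-near (double-cancel-≤ (ℕP.≤-trans 2K≤i i≤2M))
      in ℚP.≤-trans lower pairs≤alt ,
         (begin
           alt i                            ≤⟨ alt≤pairs ⟩
           pairs M + 1/suc i                ≤⟨ ℚP.+-mono-≤ upper (1/suc-antitone (ℕP.≤-trans (n≤double K) 2K≤i)) ⟩
           pairs K + 1/suc K + 1/suc K      ≡⟨ ℚP.+-assoc (pairs K) (1/suc K) (1/suc K) ⟩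
           pairs K + (1/suc K + 1/suc K)    ∎)
      where open ℚP.≤-Reasoning

    alt-cauchy : Cauchy alt
    alt-cauchy ε 0<ε =
      let (K , thrice<ε) = recip-archimedean ε 0<ε
          width : ∀ s e → s + (e + e) - (s - e) ≡ e + e + e
          width = solve 2 (λ s e → s :+ (e :+ e) :- (s :- e) := e :+ e :+ e) refl
      in double K , λ i j 2K≤i 2K≤j → ℚP.≤-<-trans
           (subst (∣ alt i - alt j ∣ ≤_) (width (pairs K) (1/suc K))
             (∣x-y∣≤hi-lo (proj₁ (alt-near 2K≤i)) (proj₂ (alt-near 2K≤i)) (proj₁ (alt-near 2K≤j)) (proj₂ (alt-near 2K≤j))))
           thrice<ε

    alt-above : LimGt alt (lowEnv 0)
    alt-above =
      let (K , e<δ) = 1/suc-archimedean δ (p<q⇒0<q-p (lowEnv-step 0))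
      in δ - 1/suc K , p<q⇒0<q-p e<δ , suc K , above K
      where
      δ = lowEnv 1 - lowEnv 0
      above : ∀ K i → suc K ℕ.≤ i → lowEnv 0 + (δ - 1/suc K) ≤ alt i
      above K i K<i =
        let (M , i≤2M , pairs≤alt , _) = alt-bracket i
        in begin
          lowEnv 0 + (δ - 1/suc K)  ≡⟨ solve 3 (λ a b e → a :+ ((b :- a) :- e) := b :- e) refl (lowEnv 0) (lowEnv 1) (1/suc K) ⟩
          lowEnv 1 - 1/suc K        ≤⟨ ℚP.+-monoˡ-≤ (- 1/suc K) (lowEnv-mono (pos-of-double (ℕP.≤-trans (s≤s z≤n) K<i) i≤2M)) ⟩
          lowEnv M - 1/suc K        ≤⟨ pairs-above (ℕP.≤-trans (ℕP.n≤1+n K) (ℕP.≤-trans K<i i≤2M)) ⟩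
          pairs M                   ≤⟨ pairs≤alt ⟩
          alt i                     ∎
        where open ℚP.≤-Reasoning

    alt-below : LimLt alt (highEnv 0)
    alt-below =
      let (K , e<δ) = 1/suc-archimedean δ (p<q⇒0<q-p (highEnv-step 0))
      in δ - 1/suc K , p<q⇒0<q-p e<δ , suc K , below K
      where
      δ = highEnv 0 - highEnv 1
      below : ∀ K i → suc K ℕ.≤ i → alt i + (δ - 1/suc K) ≤ highEnv 0
      below K i K<i =
        let (M , i≤2M , _ , alt≤pairs) = alt-bracket i
            1≤M = pos-of-double (ℕP.≤-trans (s≤s z≤n) K<i) i≤2M
        in begin
          alt i + (δ - 1/suc K)              ≤⟨ ℚP.+-monoˡ-≤ (δ - 1/suc K) alt≤pairs ⟩
          pairs M + 1/suc i + (δ - 1/suc K)  ≤⟨ ℚP.+-monoˡ-≤ (δ - 1/suc K) (ℚP.+-monoʳ-≤ (pairs M) (1/suc-antitone K≤i)) ⟩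
          pairs M + 1/suc K + (δ - 1/suc K)  ≡⟨ solve 3 (λ s e d → s :+ e :+ (d :- e) := s :+ d) refl (pairs M) (1/suc K) δ ⟩
          pairs M + δ                        ≤⟨ ℚP.+-monoˡ-≤ δ (ℚP.≤-trans (pairs≤highEnv M) (highEnv-antitone 1≤M)) ⟩
          highEnv 1 + δ                      ≡⟨ solve 2 (λ a b → b :+ (a :- b) := a) refl (highEnv 0) (highEnv 1) ⟩
          highEnv 0                          ∎
        where
        open ℚP.≤-Reasoning
        K≤i = ℕP.≤-trans (ℕP.n≤1+n K) K<i

module ReciprocalTails where
  open import Data.Nat as ℕ using (ℕ; zero; suc; z≤n; s≤s; _%_; NonZero)
  import Data.Nat.Properties as ℕP
  open import Data.Integer using (+_; -[1+_])
  open import Data.Rational using (ℚ; 1ℚ; _+_; _-_; _*_; -_; _≤_; _<_; ∣_∣)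
  import Data.Rational.Properties as ℚP
  open import Data.Rational.Solver using (module +-*-Solver)
  open +-*-Solver using (solve; _:+_; _:-_; :-_; _:*_; _:=_; con)
  open import Data.Product using (_×_; _,_)
  open import Relation.Binary.PropositionalEquality
  open Reciprocals
  open AlternatingSeries

  negOnePow-+ : ∀ a b → negOnePow (a ℕ.+ b) ≡ negOnePow a * negOnePow b
  negOnePow-+ zero b = sym (ℚP.*-identityˡ (negOnePow b))
  negOnePow-+ (suc a) b = trans (cong -_ (negOnePow-+ a b)) (ℚP.neg-distribˡ-* (negOnePow a) (negOnePow b))

  negOnePow-even : ∀ n → n % 2 ≡ 0 → negOnePow n ≡ 1ℚ
  negOnePow-odd : ∀ n → n % 2 ≡ 1 → negOnePow n ≡ - 1ℚ
  negOnePow-even zero _ = refl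
  negOnePow-even (suc (suc n)) even = trans (solve 1 (λ x → :- (:- x) := x) refl (negOnePow n)) (negOnePow-even n even)
  negOnePow-odd (suc zero) _ = refl
  negOnePow-odd (suc (suc n)) odd = trans (solve 1 (λ x → :- (:- x) := x) refl (negOnePow n)) (negOnePow-odd n odd)

  module _ {s t : ℕ → ℚ} (s≡t : ∀ i → s i ≡ t i) where
    Cauchy-cong : Cauchy s → Cauchy t
    Cauchy-cong cauchy ε 0<ε =
      let (N , close) = cauchy ε 0<ε
      in N , λ i j N≤i N≤j → subst (λ d → ∣ d ∣ < ε) (cong₂ _-_ (s≡t i) (s≡t j)) (close i j N≤i N≤j)

    LimGt-cong : ∀ {q} → LimGt s q → LimGt t q
    LimGt-cong (ε , 0<ε , N , above) = ε , 0<ε , N , λ i N≤i → subst (_ ≤_) (s≡t i) (above i N≤i)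

    LimLe-cong : ∀ {q} → LimLe s q → LimLe t q
    LimLe-cong below ε 0<ε =
      let (N , below-ε) = below ε 0<ε
      in N , λ i N≤i → subst (_≤ _) (s≡t i) (below-ε i N≤i)

  Cauchy-neg : ∀ {s} → Cauchy s → Cauchy (λ i → - s i)
  Cauchy-neg {s} cauchy ε 0<ε =
    let (N , close) = cauchy ε 0<ε
    in N , λ i j N≤i N≤j → subst (_< ε)
         (trans (sym (ℚP.∣-p∣≡∣p∣ (s i - s j))) (cong ∣_∣ (solve 2 (λ a b → :- (a :- b) := (:- a) :- (:- b)) refl (s i) (s j))))
         (close i j N≤i N≤j)

  LimLt⇒LimLe : ∀ {s q} → LimLt s q → LimLe s q
  LimLt⇒LimLe {s} {q} (ε , 0<ε , N , below) δ 0<δ = N , λ i N≤i → begin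
    s i          ≤⟨ p≤p+q (s i) (ℚP.<⇒≤ 0<ε) ⟩
    s i + ε      ≤⟨ below i N≤i ⟩
    q            ≤⟨ p≤p+q q (ℚP.<⇒≤ 0<δ) ⟩
    q + δ        ∎
    where open ℚP.≤-Reasoning

  LimLt-neg : ∀ {s q} → LimLt s q → LimGt (λ i → - s i) (- q)
  LimLt-neg {s} {q} (ε , 0<ε , N , below) = ε , 0<ε , N , λ i N≤i →
    subst (- q + ε ≤_) (solve 2 (λ x e → :- (x :+ e) :+ e := :- x) refl (s i) ε)
      (ℚP.+-monoˡ-≤ ε (ℚP.neg-antimono-≤ (below i N≤i)))

  LimGt-neg : ∀ {s q} → LimGt s q → LimLe (λ i → - s i) (- q)
  LimGt-neg {s} {q} (ε , 0<ε , N , above) δ 0<δ = N , λ i N≤i → begin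
    - s i                  ≤⟨ ℚP.neg-antimono-≤ (above i N≤i) ⟩
    - (q + ε)              ≤⟨ p≤p+q (- (q + ε)) (ℚP.+-mono-≤ (ℚP.<⇒≤ 0<ε) (ℚP.<⇒≤ 0<δ)) ⟩
    - (q + ε) + (ε + δ)    ≡⟨ solve 3 (λ q e d → :- (q :+ e) :+ (e :+ d) := :- q :+ d) refl q ε δ ⟩
    - q + δ                ∎
    where open ℚP.≤-Reasoning

  floorRecip-pos : ∀ {s t} c .{{_ : NonZero c}} → (∀ i → s i ≡ t i) →
    Cauchy s → LimGt s (recip (suc c)) → LimLt s (recip c) → FloorRecipLim t (+ c)
  floorRecip-pos (suc k) s≡t cauchy above below =
    Cauchy-cong s≡t cauchy ,
    LimGt-cong s≡t {recip (suc (suc k))} above ,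
    LimLe-cong s≡t {recip (suc k)} (LimLt⇒LimLe below)

  floorRecip-neg : ∀ {s t} c .{{_ : NonZero c}} → (∀ i → - s i ≡ t i) →
    Cauchy s → LimGt s (recip (suc c)) → LimLt s (recip c) → FloorRecipLim t -[1+ c ]
  floorRecip-neg {s} (suc k) -s≡t cauchy above below =
    Cauchy-cong -s≡t (Cauchy-neg {s} cauchy) ,
    LimGt-cong -s≡t {q = - recip (suc k)} (LimLt-neg {s} {recip (suc k)} below) ,
    LimLe-cong -s≡t {q = - recip (suc (suc k))} (LimGt-neg {s} {recip (suc (suc k))} above)

  recip-bounded : ∀ n (e : ℕ → ℕ) → (∀ j → suc (n ℕ.+ j) ℕ.≤ e j) → HarmonicallyBounded (λ j → recip (e j))
  recip-bounded n e large j = recip-nonNeg (e j) , recip-antitone {suc j} {e j} (ℕP.≤-trans (s≤s (ℕP.m≤n+m j n)) (large j))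

  module _ (d c : ℕ → ℕ) (n₀ : ℕ)
    (lower : ∀ k → n₀ ℕ.≤ k → recip (suc (c k)) + recip (d (suc k)) < recip (d k) + recip (suc (c (2 ℕ.+ k))))
    (upper : ∀ k → n₀ ℕ.≤ k → recip (d k) + recip (c (2 ℕ.+ k)) < recip (c k) + recip (d (suc k)))
    (d-large : ∀ k → n₀ ℕ.≤ k → suc k ℕ.≤ d k)
    (c-large : ∀ k → n₀ ℕ.≤ k → suc k ℕ.≤ c k)
    (n : ℕ) (n₀≤n : n₀ ℕ.≤ n)
    where

    private
      n₀≤ : ∀ j → n₀ ℕ.≤ n ℕ.+ j
      n₀≤ j = ℕP.≤-trans n₀≤n (ℕP.m≤m+n n j)


      n+suc : ∀ j → n ℕ.+ suc j ≡ suc (n ℕ.+ j)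
      n+suc = ℕP.+-suc n

      n+2+ : ∀ j → n ℕ.+ suc (suc j) ≡ 2 ℕ.+ (n ℕ.+ j)
      n+2+ j = trans (n+suc (suc j)) (cong suc (n+suc j))

    open Squeeze (λ j → recip (d (n ℕ.+ j))) (λ j → recip (suc (c (n ℕ.+ j)))) (λ j → recip (c (n ℕ.+ j)))
      (λ M → subst₂ (λ a b → recip (suc (c (n ℕ.+ double M))) + recip (d a) < recip (d (n ℕ.+ double M)) + recip (suc (c b)))
               (sym (n+suc (double M))) (sym (n+2+ (double M))) (lower (n ℕ.+ double M) (n₀≤ (double M))))
      (λ M → subst₂ (λ a b → recip (d (n ℕ.+ double M)) + recip (c b) < recip (c (n ℕ.+ double M)) + recip (d a))
               (sym (n+suc (double M))) (sym (n+2+ (double M))) (upper (n ℕ.+ double M) (n₀≤ (double M))))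
      (recip-bounded n (λ j → d (n ℕ.+ j)) (λ j → d-large (n ℕ.+ j) (n₀≤ j)))
      (recip-bounded n (λ j → suc (c (n ℕ.+ j))) (λ j → s≤s (ℕP.<⇒≤ (c-large (n ℕ.+ j) (n₀≤ j)))))
      (recip-bounded n (λ j → c (n ℕ.+ j)) (λ j → c-large (n ℕ.+ j) (n₀≤ j)))

    altTail≡alt : ∀ N → altTail (λ k → recip (d k)) n N ≡ negOnePow n * alt N
    altTail≡alt zero = cong (λ k → negOnePow n * recip (d k)) (sym (ℕP.+-identityʳ n))
    altTail≡alt (suc N) = trans
      (cong₂ (λ a σ → a + σ * recip (d (n ℕ.+ suc N))) (altTail≡alt N) (negOnePow-+ n (suc N)))
      (solve 4 (λ σ a τ x → σ :* a :+ σ :* τ :* x := σ :* (a :+ τ :* x)) refl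
        (negOnePow n) (alt N) (negOnePow (suc N)) (recip (d (n ℕ.+ suc N))))

    private
      c-nonZero : NonZero (c n)
      c-nonZero = ℕ.>-nonZero (ℕP.≤-trans (s≤s z≤n) (c-large n n₀≤n))

      lowEnv₀ : lowEnv 0 ≡ recip (suc (c n))
      lowEnv₀ = trans (ℚP.+-identityˡ _) (cong (λ k → recip (suc (c k))) (ℕP.+-identityʳ n))

      highEnv₀ : highEnv 0 ≡ recip (c n)
      highEnv₀ = trans (ℚP.+-identityˡ _) (cong (λ k → recip (c k)) (ℕP.+-identityʳ n))

    private
      alt-above′ : LimGt alt (recip (suc (c n)))
      alt-above′ = subst (LimGt alt) lowEnv₀ alt-above

      alt-below′ : LimLt alt (recip (c n))
      alt-below′ = subst (LimLt alt) highEnv₀ alt-below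

    floorRecip-altTail-even : n % 2 ≡ 0 → FloorRecipLim (altTail (λ k → recip (d k)) n) (+ c n)
    floorRecip-altTail-even even = floorRecip-pos (c n) {{c-nonZero}} alt≡tail alt-cauchy alt-above′ alt-below′
      where
      alt≡tail : ∀ N → alt N ≡ altTail (λ k → recip (d k)) n N
      alt≡tail N = sym (trans (altTail≡alt N) (trans (cong (_* alt N) (negOnePow-even n even)) (ℚP.*-identityˡ (alt N))))

    floorRecip-altTail-odd : n % 2 ≡ 1 → FloorRecipLim (altTail (λ k → recip (d k)) n) -[1+ c n ]
    floorRecip-altTail-odd odd = floorRecip-neg (c n) {{c-nonZero}} -alt≡tail alt-cauchy alt-above′ alt-below′
      where
      -alt≡tail : ∀ N → - alt N ≡ altTail (λ k → recip (d k)) n N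
      -alt≡tail N = sym (trans (altTail≡alt N) (trans (cong (_* alt N) (negOnePow-odd n odd))
                      (solve 1 (λ a → (:- con 1ℚ) :* a := :- a) refl (alt N))))

    floorRecip-altTail : (n % 2 ≡ 0 → FloorRecipLim (altTail (λ k → recip (d k)) n) (+ c n))
                       × (n % 2 ≡ 1 → FloorRecipLim (altTail (λ k → recip (d k)) n) -[1+ c n ])
    floorRecip-altTail = floorRecip-altTail-even , floorRecip-altTail-odd

module Balancing where
  open import Data.Nat
  open import Data.Nat.Properties
  open import Data.Nat.Tactic.RingSolver using (solve)
  open import Data.List using (_∷_; [])
  open import Relation.Binary.PropositionalEquality

  B-<-suc : ∀ n → B n < B (suc n)
  B-<-suc zero = s≤s z≤n
  B-<-suc (suc n) = grow (B-<-suc n)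
    where
    grow : ∀ {x y} → x < y → y < 6 * y ∸ x
    grow {x} {suc y} x<y = begin-strict
      suc y             <⟨ m<m+n (suc y) (s≤s z≤n) ⟩
      suc y + 4 * suc y ≡⟨ m+n∸m≡n (suc y) (5 * suc y) ⟨
      6 * suc y ∸ suc y ≤⟨ ∸-monoʳ-≤ (6 * suc y) (<⇒≤ x<y) ⟩
      6 * suc y ∸ x     ∎
      where open ≤-Reasoning

  B-rec : ∀ n → B (2 + n) + B n ≡ 6 * B (1 + n)
  B-rec n = m∸n+n≡m (≤-trans (<⇒≤ (B-<-suc n)) (m≤m+n (B (1 + n)) (5 * B (1 + n))))

  n≤B : ∀ n → n ≤ B n
  n≤B zero = z≤n
  n≤B (suc n) = ≤-trans (s≤s (n≤B n)) (B-<-suc n)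

  B-cassini : ∀ n → B (1 + n) * B (1 + n) + B n * B n ≡ 6 * B n * B (1 + n) + 1
  B-cassini zero = refl
  B-cassini (suc n) = step (B n) (B (1 + n)) (B (2 + n)) (B-rec n) (B-cassini n)
    where
    step : ∀ x y z → z + x ≡ 6 * y → y * y + x * x ≡ 6 * x * y + 1 → z * z + y * y ≡ 6 * y * z + 1
    step x y z rec ih = +-cancelʳ-≡ (x * z + x * x) _ _ (begin
      z * z + y * y + (x * z + x * x) ≡⟨ solve (x ∷ y ∷ z ∷ []) ⟩
      z * (z + x) + (y * y + x * x)   ≡⟨ cong₂ (λ u v → z * u + v) rec ih ⟩
      z * (6 * y) + (6 * x * y + 1)   ≡⟨ solve (x ∷ y ∷ z ∷ []) ⟩
      6 * y * z + 1 + x * (6 * y)     ≡⟨ cong (λ u → 6 * y * z + 1 + x * u) rec ⟨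
      6 * y * z + 1 + x * (z + x)     ≡⟨ solve (x ∷ y ∷ z ∷ []) ⟩
      6 * y * z + 1 + (x * z + x * x) ∎)
      where open ≡-Reasoning

  B-neighbours : ∀ n → B n * B (2 + n) ≡ B (1 + n) * B (1 + n) ∸ 1
  B-neighbours n = sym (trans (cong (_∸ 1) (step (B n) (B (1 + n)) (B (2 + n)) (B-rec n) (B-cassini n))) (m+n∸n≡m _ 1))
    where
    step : ∀ x y z → z + x ≡ 6 * y → y * y + x * x ≡ 6 * x * y + 1 → y * y ≡ x * z + 1
    step x y z rec cassini = +-cancelʳ-≡ (x * x) _ _ (begin
      y * y + x * x        ≡⟨ cassini ⟩
      6 * x * y + 1        ≡⟨ solve (x ∷ y ∷ []) ⟩
      x * (6 * y) + 1      ≡⟨ cong (λ u → x * u + 1) rec ⟨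
      x * (z + x) + 1      ≡⟨ solve (x ∷ z ∷ []) ⟩
      x * z + 1 + x * x    ∎)
      where open ≡-Reasoning

module BalancingIdentities where
  open import Data.Nat as ℕ using (ℕ; zero; suc)
  open import Data.Integer using (ℤ; +_; _+_; _-_; _*_; -_)
  import Data.Integer.Properties as ℤP
  open import Data.Integer.Tactic.RingSolver using (solve-∀; solve)
  open import Data.List using (_∷_; [])
  open import Relation.Binary.PropositionalEquality
  open Balancing

  β : ℕ → ℤ
  β n = + B n

  β-rec : ∀ n → β (2 ℕ.+ n) ≡ + 6 * β (1 ℕ.+ n) - β n
  β-rec n = isolate (trans (sym (ℤP.pos-+ (B (2 ℕ.+ n)) (B n))) (trans (cong +_ (B-rec n)) (ℤP.pos-* 6 (B (1 ℕ.+ n)))))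
    where
    isolate : ∀ {a b c} → a + b ≡ c → a ≡ c - b
    isolate {a} {b} {c} refl = solve (a ∷ b ∷ [])

  β-up : ∀ k m → β (suc k ℕ.+ m) ≡ β (suc k) * β (suc m) - β k * β m
  β-up zero m = base (β m) (β (suc m))
    where
    base : ∀ x y → y ≡ + 1 * y - + 0 * x
    base = solve-∀
  β-up (suc zero) m = trans (β-rec m) (base (β m) (β (suc m)))
    where
    base : ∀ x y → + 6 * y - x ≡ + 6 * y - + 1 * x
    base = solve-∀
  β-up (suc (suc k)) m = begin
    β (3 ℕ.+ k ℕ.+ m)                                                ≡⟨ β-rec (suc k ℕ.+ m) ⟩
    + 6 * β (2 ℕ.+ k ℕ.+ m) - β (1 ℕ.+ k ℕ.+ m)                      ≡⟨ cong₂ (λ u v → + 6 * u - v) (β-up (suc k) m) (β-up k m) ⟩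
    + 6 * (β (2 ℕ.+ k) * y - β (1 ℕ.+ k) * x) - (β (1 ℕ.+ k) * y - β k * x)  ≡⟨ step (β (2 ℕ.+ k)) (β (1 ℕ.+ k)) (β k) x y ⟩
    (+ 6 * β (2 ℕ.+ k) - β (1 ℕ.+ k)) * y - (+ 6 * β (1 ℕ.+ k) - β k) * x  ≡⟨ cong₂ (λ u v → u * y - v * x) (β-rec (suc k)) (β-rec k) ⟨
    β (3 ℕ.+ k) * y - β (2 ℕ.+ k) * x                                ∎
    where
    open ≡-Reasoning
    x = β m
    y = β (suc m)
    step : ∀ a b c x y → + 6 * (a * y - b * x) - (b * y - c * x) ≡ (+ 6 * a - b) * y - (+ 6 * b - c) * x
    step = solve-∀

  β-down : ∀ k j → β j ≡ β (suc k) * β (k ℕ.+ j) - β k * β (suc k ℕ.+ j)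
  β-down zero j = base (β j) (β (suc j))
    where
    base : ∀ x y → x ≡ + 1 * x - + 0 * y
    base = solve-∀
  β-down (suc k) j = begin
    β j                                         ≡⟨ β-down k j ⟩
    β (suc k) * β (k ℕ.+ j) - β k * v           ≡⟨ cong (λ t → β (suc k) * t - β k * v) (isolate v (β (k ℕ.+ j)) (β-rec (k ℕ.+ j))) ⟩
    β (suc k) * (+ 6 * v - w) - β k * v         ≡⟨ step (β (suc k)) (β k) v w ⟩
    (+ 6 * β (suc k) - β k) * v - β (suc k) * w ≡⟨ cong (λ t → t * v - β (suc k) * w) (β-rec k) ⟨
    β (2 ℕ.+ k) * v - β (suc k) * w             ∎
    where
    open ≡-Reasoning
    v = β (1 ℕ.+ k ℕ.+ j)
    w = β (2 ℕ.+ k ℕ.+ j)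
    isolate : ∀ b c {a} → a ≡ + 6 * b - c → c ≡ + 6 * b - a
    isolate b c refl = swap b c
      where
      swap : ∀ b c → c ≡ + 6 * b - (+ 6 * b - c)
      swap = solve-∀
    step : ∀ a b u v → a * (+ 6 * u - v) - b * u ≡ (+ 6 * a - b) * u - a * v
    step = solve-∀

  β-cassini : ∀ m → β (1 ℕ.+ m) * β (1 ℕ.+ m) + β m * β m - + 6 * β m * β (1 ℕ.+ m) ≡ + 1
  β-cassini m = begin
    y * y + x * x - + 6 * x * y                                ≡⟨ cong (_- + 6 * x * y) squares ⟩
    + (B (1 ℕ.+ m) ℕ.* B (1 ℕ.+ m) ℕ.+ B m ℕ.* B m) - + 6 * x * y  ≡⟨ cong (λ u → + u - + 6 * x * y) (B-cassini m) ⟩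
    + (6 ℕ.* B m ℕ.* B (1 ℕ.+ m) ℕ.+ 1) - + 6 * x * y         ≡⟨ cong (_- + 6 * x * y) product ⟩
    + 6 * x * y + + 1 - + 6 * x * y                            ≡⟨ cancel (+ 6 * x * y) ⟩
    + 1                                                        ∎
    where
    open ≡-Reasoning
    x = β m
    y = β (1 ℕ.+ m)
    squares : y * y + x * x ≡ + (B (1 ℕ.+ m) ℕ.* B (1 ℕ.+ m) ℕ.+ B m ℕ.* B m)
    squares = sym (trans (ℤP.pos-+ (B (1 ℕ.+ m) ℕ.* B (1 ℕ.+ m)) (B m ℕ.* B m))
                   (cong₂ _+_ (ℤP.pos-* (B (1 ℕ.+ m)) (B (1 ℕ.+ m))) (ℤP.pos-* (B m) (B m))))
    product : + (6 ℕ.* B m ℕ.* B (1 ℕ.+ m) ℕ.+ 1) ≡ + 6 * x * y + + 1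
    product = trans (ℤP.pos-+ (6 ℕ.* B m ℕ.* B (1 ℕ.+ m)) 1)
                (cong (_+ + 1) (trans (ℤP.pos-* (6 ℕ.* B m) (B (1 ℕ.+ m))) (cong (_* y) (ℤP.pos-* 6 (B m)))))
    cancel : ∀ a → a + + 1 - a ≡ + 1
    cancel = solve-∀

  window-low : ∀ m → β m ≡ + 204 * β (3 ℕ.+ m) - + 35 * β (4 ℕ.+ m)
  window-low m = trans (β-down 3 m) (cong₂ (λ u v → u * β (3 ℕ.+ m) - v * β (4 ℕ.+ m)) {β 4} {+ 204} {β 3} {+ 35} refl refl)

  window-mid : ∀ m → β (2 ℕ.+ m) ≡ + 6 * β (3 ℕ.+ m) - β (4 ℕ.+ m)
  window-mid m = trans (β-down 1 (2 ℕ.+ m))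
    (cong₂ (λ u v → u * β (3 ℕ.+ m) - v) {β 2} {+ 6} {β 1 * β (4 ℕ.+ m)} {β (4 ℕ.+ m)} refl (ℤP.*-identityˡ (β (4 ℕ.+ m))))

  window-high : ∀ m → β (6 ℕ.+ m) ≡ + 35 * β (4 ℕ.+ m) - + 6 * β (3 ℕ.+ m)
  window-high m = trans (β-up 2 (3 ℕ.+ m)) (cong₂ (λ u v → u * β (4 ℕ.+ m) - v * β (3 ℕ.+ m)) {β 3} {+ 35} {β 2} {+ 6} refl refl)

  -- x = B_{m+3} and y = B_{m+4}; then B_{m+2} = 6x - y, B_m = 204x - 35y and B_{m+6} = 35y - 6x.
  module WindowAlgebra (x y : ℤ) (cassini : y * y + x * x - + 6 * x * y ≡ + 1) where
    private
      via-cassini : ∀ r c {l} → l ≡ r + c * (y * y + x * x - + 6 * x * y) → l ≡ r + c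
      via-cassini r c l≡ = trans l≡ (trans (cong (λ q → r + c * q) cassini) (cong (λ q → r + q) (ℤP.*-identityʳ c)))

    catalan-inner : y * (+ 6 * x - y) ≡ x * x - + 1
    catalan-inner = via-cassini (x * x) (- + 1) (expand x y)
      where
      expand : ∀ x y → y * (+ 6 * x - y) ≡ x * x + - + 1 * (y * y + x * x - + 6 * x * y)
      expand = solve-∀

    catalan-low : y * (+ 204 * x - + 35 * y) ≡ (+ 6 * x - y) * (+ 6 * x - y) - + 36
    catalan-low = via-cassini ((+ 6 * x - y) * (+ 6 * x - y)) (- + 36) (expand x y)
      where
      expand : ∀ x y → y * (+ 204 * x - + 35 * y) ≡ (+ 6 * x - y) * (+ 6 * x - y) + - + 36 * (y * y + x * x - + 6 * x * y)
      expand = solve-∀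

    catalan-high : (+ 35 * y - + 6 * x) * (+ 6 * x - y) ≡ y * y - + 36
    catalan-high = via-cassini (y * y) (- + 36) (expand x y)
      where
      expand : ∀ x y → (+ 35 * y - + 6 * x) * (+ 6 * x - y) ≡ y * y + - + 36 * (y * y + x * x - + 6 * x * y)
      expand = solve-∀

    catalan-outer : (+ 35 * y - + 6 * x) * (+ 204 * x - + 35 * y) ≡ x * x - + 1225
    catalan-outer = via-cassini (x * x) (- + 1225) (expand x y)
      where
      expand : ∀ x y → (+ 35 * y - + 6 * x) * (+ 204 * x - + 35 * y) ≡ x * x + - + 1225 * (y * y + x * x - + 6 * x * y)
      expand = solve-∀

    squares-inner : (+ 6 * x - y) * (+ 6 * x - y) + y * y ≡ + 34 * (x * x) + + 2
    squares-inner = via-cassini (+ 34 * (x * x)) (+ 2) (expand x y)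
      where
      expand : ∀ x y → (+ 6 * x - y) * (+ 6 * x - y) + y * y ≡ + 34 * (x * x) + + 2 * (y * y + x * x - + 6 * x * y)
      expand = solve-∀

    squares-outer : (+ 204 * x - + 35 * y) * (+ 204 * x - + 35 * y) + (+ 35 * y - + 6 * x) * (+ 35 * y - + 6 * x)
                    ≡ + 39202 * (x * x) + + 2450
    squares-outer = via-cassini (+ 39202 * (x * x)) (+ 2450) (expand x y)
      where
      expand : ∀ x y → (+ 204 * x - + 35 * y) * (+ 204 * x - + 35 * y) + (+ 35 * y - + 6 * x) * (+ 35 * y - + 6 * x)
                       ≡ + 39202 * (x * x) + + 2450 * (y * y + x * x - + 6 * x * y)
      expand = solve-∀

    squares-gap : (+ 35 * y - + 6 * x) * (+ 35 * y - + 6 * x) - (+ 204 * x - + 35 * y) * (+ 204 * x - + 35 * y)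
                  ≡ + 1155 * (y * y - (+ 6 * x - y) * (+ 6 * x - y))
    squares-gap = expand x y
      where
      expand : ∀ x y → (+ 35 * y - + 6 * x) * (+ 35 * y - + 6 * x) - (+ 204 * x - + 35 * y) * (+ 204 * x - + 35 * y)
                       ≡ + 1155 * (y * y - (+ 6 * x - y) * (+ 6 * x - y))
      expand = solve-∀

module PairGaps where
  open import Data.Nat as ℕ using (ℕ; zero; suc; z≤n; s≤s)
  open import Data.Integer using (ℤ; +_; +[1+_]; _+_; _-_; _*_; -_; _<_; +<+)
  import Data.Integer.Properties as ℤP
  open import Data.Integer.Tactic.RingSolver using (solve-∀; solve)
  open import Data.List using (_∷_; [])
  open import Relation.Binary.PropositionalEquality

  squared : ∀ u v {w} → u * v ≡ w → (u * u) * (v * v) ≡ w * w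
  squared u v refl = solve (u ∷ v ∷ [])

  <-of-gap : ∀ {x y g k} → y - x ≡ g * k → + 0 < g → + 0 < k → x < y
  <-of-gap {x} {y} {+[1+ g ]} {+[1+ k ]} gap _ _ = subst₂ _<_ (ℤP.+-identityʳ x) (trans (cong (λ d → x + d) (sym gap)) (solve (x ∷ y ∷ [])))
    (ℤP.+-monoʳ-< x (+<+ (s≤s z≤n)))
  <-of-gap {g = + zero} _ (+<+ ()) _
  <-of-gap {g = +[1+ _ ]} {k = + zero} _ _ (+<+ ())

  -- Polynomials in δ and F = B_{m+3}² - 1225 = B_{m+6}B_m, positive for δ ∈ {0, 1} and F ≥ 0.
  gapᵁ gapᴸ : ℤ → ℤ → ℤ
  gapᵁ δ F = (+ 2448 - + 68 * δ) * F + + 1496880 - + 83160 * δ + + 1155 * δ * δ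
  gapᴸ δ F = (+ 36788 + + 68 * δ) * F + + 46569673 + + 83158 * δ - + 1155 * δ * δ

  -- P, A, N, C, S stand for B_m², B_{m+2}², B_{m+3}², B_{m+4}², B_{m+6}²; the left-hand sides below are
  -- the differences of the two sides of the pair inequalities, cross-multiplied as in recip-+-<.
  module GapIdentities (P A N C S δ : ℤ)
    (SA : S * A ≡ (C - + 36) * (C - + 36)) (CP : C * P ≡ (A - + 36) * (A - + 36))
    (SP : S * P ≡ (N - + 1225) * (N - + 1225)) (CA : C * A ≡ (N - + 1) * (N - + 1))
    (A+C : A + C ≡ + 34 * N + + 2) (P+S : P + S ≡ + 39202 * N + + 2450) (S-P : S - P ≡ + 1155 * (C - A))
    where

    upper-gap : (A + P - δ + (C - δ)) * ((A - δ) * (S + C - δ)) - (A - δ + (S + C - δ)) * ((A + P - δ) * (C - δ))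
                ≡ (C - A) * gapᵁ δ (N - + 1225)
    upper-gap = begin
      (A + P - δ + (C - δ)) * ((A - δ) * (S + C - δ)) - (A - δ + (S + C - δ)) * ((A + P - δ) * (C - δ))
        ≡⟨ solve (P ∷ A ∷ C ∷ S ∷ δ ∷ []) ⟩
      (S * A) * A - (C * P) * C + (S * P) * (A - C) - + 2 * δ * (S * A - C * P) + δ * δ * (S - P)
        ≡⟨ cong₂ (λ u v → u * A - v * C + (S * P) * (A - C) - + 2 * δ * (u - v) + δ * δ * (S - P)) SA CP ⟩
      (C - + 36) * (C - + 36) * A - (A - + 36) * (A - + 36) * C + (S * P) * (A - C)
        - + 2 * δ * ((C - + 36) * (C - + 36) - (A - + 36) * (A - + 36)) + δ * δ * (S - P)
        ≡⟨ cong₂ (λ u v → (C - + 36) * (C - + 36) * A - (A - + 36) * (A - + 36) * C + u * (A - C)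
                          - + 2 * δ * ((C - + 36) * (C - + 36) - (A - + 36) * (A - + 36)) + δ * δ * v) SP S-P ⟩
      (C - + 36) * (C - + 36) * A - (A - + 36) * (A - + 36) * C + (N - + 1225) * (N - + 1225) * (A - C)
        - + 2 * δ * ((C - + 36) * (C - + 36) - (A - + 36) * (A - + 36)) + δ * δ * (+ 1155 * (C - A))
        ≡⟨ solve (A ∷ N ∷ C ∷ δ ∷ []) ⟩
      (C - A) * (C * A - + 1296 - (N - + 1225) * (N - + 1225) - + 2 * δ * (A + C - + 72) + + 1155 * δ * δ)
        ≡⟨ cong₂ (λ u v → (C - A) * (u - + 1296 - (N - + 1225) * (N - + 1225) - + 2 * δ * (v - + 72) + + 1155 * δ * δ)) CA A+C ⟩
      (C - A) * ((N - + 1) * (N - + 1) - + 1296 - (N - + 1225) * (N - + 1225) - + 2 * δ * (+ 34 * N + + 2 - + 72) + + 1155 * δ * δ)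
        ≡⟨ solve (N ∷ C ∷ A ∷ δ ∷ []) ⟩
      (C - A) * ((+ 2448 - + 68 * δ) * (N - + 1225) + + 1496880 - + 83160 * δ + + 1155 * δ * δ) ∎
      where open ≡-Reasoning

    lower-gap : (A - δ + (+ 1 + (S + C - δ))) * ((+ 1 + (A + P - δ)) * (C - δ))
                  - (+ 1 + (A + P - δ) + (C - δ)) * ((A - δ) * (+ 1 + (S + C - δ)))
                ≡ (C - A) * gapᴸ δ (N - + 1225)
    lower-gap = begin
      (A - δ + (+ 1 + (S + C - δ))) * ((+ 1 + (A + P - δ)) * (C - δ))
        - (+ 1 + (A + P - δ) + (C - δ)) * ((A - δ) * (+ 1 + (S + C - δ)))
        ≡⟨ solve (P ∷ A ∷ C ∷ S ∷ δ ∷ []) ⟩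
      (C - A) * (P + S + + 1 + (A + C) - + 2 * δ)
        - ((A + P - δ + (C - δ)) * ((A - δ) * (S + C - δ)) - (A - δ + (S + C - δ)) * ((A + P - δ) * (C - δ)))
        ≡⟨ cong (λ u → (C - A) * (P + S + + 1 + (A + C) - + 2 * δ) - u) upper-gap ⟩
      (C - A) * (P + S + + 1 + (A + C) - + 2 * δ)
        - (C - A) * ((+ 2448 - + 68 * δ) * (N - + 1225) + + 1496880 - + 83160 * δ + + 1155 * δ * δ)
        ≡⟨ cong₂ (λ u v → (C - A) * (u + + 1 + v - + 2 * δ)
                          - (C - A) * ((+ 2448 - + 68 * δ) * (N - + 1225) + + 1496880 - + 83160 * δ + + 1155 * δ * δ)) P+S A+C ⟩
      (C - A) * (+ 39202 * N + + 2450 + + 1 + (+ 34 * N + + 2) - + 2 * δ)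
        - (C - A) * ((+ 2448 - + 68 * δ) * (N - + 1225) + + 1496880 - + 83160 * δ + + 1155 * δ * δ)
        ≡⟨ solve (N ∷ C ∷ A ∷ δ ∷ []) ⟩
      (C - A) * ((+ 36788 + + 68 * δ) * (N - + 1225) + + 46569673 + + 83158 * δ - + 1155 * δ * δ) ∎
      where open ≡-Reasoning

  affine-positive : ∀ c k f → + 0 < + suc c + + k * + f
  affine-positive c k f = subst (+ 0 <_) (trans (ℤP.pos-+ (suc c) (k ℕ.* f)) (cong (λ d → + suc c + d) (ℤP.pos-* k f)))
    (+<+ (s≤s z≤n))

  gapᵁ-positive : ∀ {δ} → δ ℕ.≤ 1 → ∀ f → + 0 < gapᵁ (+ δ) (+ f)
  gapᵁ-positive z≤n f = subst (+ 0 <_) (expand (+ f)) (affine-positive 1496879 2448 f)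
    where
    expand : ∀ F → + 1496880 + + 2448 * F ≡ (+ 2448 - + 68 * + 0) * F + + 1496880 - + 83160 * + 0 + + 1155 * + 0 * + 0
    expand = solve-∀
  gapᵁ-positive (s≤s z≤n) f = subst (+ 0 <_) (expand (+ f)) (affine-positive 1414874 2380 f)
    where
    expand : ∀ F → + 1414875 + + 2380 * F ≡ (+ 2448 - + 68 * + 1) * F + + 1496880 - + 83160 * + 1 + + 1155 * + 1 * + 1
    expand = solve-∀

  gapᴸ-positive : ∀ {δ} → δ ℕ.≤ 1 → ∀ f → + 0 < gapᴸ (+ δ) (+ f)
  gapᴸ-positive z≤n f = subst (+ 0 <_) (expand (+ f)) (affine-positive 46569672 36788 f)
    where
    expand : ∀ F → + 46569673 + + 36788 * F ≡ (+ 36788 + + 68 * + 0) * F + + 46569673 + + 83158 * + 0 - + 1155 * + 0 * + 0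
    expand = solve-∀
  gapᴸ-positive (s≤s z≤n) f = subst (+ 0 <_) (expand (+ f)) (affine-positive 46651675 36856 f)
    where
    expand : ∀ F → + 46651676 + + 36856 * F ≡ (+ 36788 + + 68 * + 1) * F + + 46569673 + + 83158 * + 1 - + 1155 * + 1 * + 1
    expand = solve-∀

module PairInequalities where
  open import Data.Nat as ℕ using (ℕ; suc; z≤n; s≤s; _∸_; NonZero)
  import Data.Nat.Properties as ℕP
  open import Data.Integer as ℤ using (ℤ; +_; _-_; _+_; _*_; -_)
  import Data.Integer.Properties as ℤP
  open import Data.Rational using (_<_)
  import Data.Rational as ℚ
  open import Relation.Binary.PropositionalEquality
  open Balancing
  open BalancingIdentities
  open PairGaps
  open Reciprocals

  -- denom 1 j = B_{j-1}B_{j+1} by B-neighbours.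
  denom : ℕ → ℕ → ℕ
  denom δ j = B j ℕ.* B j ∸ δ

  floorVal : ℕ → ℕ → ℕ
  floorVal δ j = B j ℕ.* B j ℕ.+ B (j ∸ 2) ℕ.* B (j ∸ 2) ∸ δ

  private
    1≤B : ∀ n → 1 ℕ.≤ B (suc n)
    1≤B n = ℕP.≤-trans (s≤s z≤n) (n≤B (suc n))

    δ≤square : ∀ {δ} → δ ℕ.≤ 1 → ∀ n → δ ℕ.≤ B (suc n) ℕ.* B (suc n)
    δ≤square δ≤1 n = ℕP.≤-trans δ≤1 (ℕP.*-mono-≤ (1≤B n) (1≤B n))

    ∸-cast : ∀ {δ n} → δ ℕ.≤ n → + (n ∸ δ) ≡ + n - + δ
    ∸-cast {δ} {n} δ≤n = sym (trans (ℤP.m-n≡m⊖n n δ) (ℤP.⊖-≥ δ≤n))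

    denom-cast : ∀ {δ} → δ ℕ.≤ 1 → ∀ n → + denom δ (suc n) ≡ β (suc n) * β (suc n) - + δ
    denom-cast δ≤1 n = trans (∸-cast (δ≤square δ≤1 n)) (cong (_- _) (ℤP.pos-* (B (suc n)) (B (suc n))))

    floorVal-cast : ∀ {δ} → δ ℕ.≤ 1 → ∀ n → + floorVal δ (suc (suc n)) ≡ β (2 ℕ.+ n) * β (2 ℕ.+ n) + β n * β n - + δ
    floorVal-cast {δ} δ≤1 n = trans (∸-cast (ℕP.≤-trans (δ≤square δ≤1 (suc n)) (ℕP.m≤m+n _ _)))
      (cong (_- + δ) (trans (ℤP.pos-+ (B (2 ℕ.+ n) ℕ.* B (2 ℕ.+ n)) (B n ℕ.* B n))
                            (cong₂ _+_ (ℤP.pos-* (B (2 ℕ.+ n)) (B (2 ℕ.+ n))) (ℤP.pos-* (B n) (B n)))))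

    denom-nonZero : ∀ {δ} → δ ℕ.≤ 1 → ∀ n → NonZero (denom δ (2 ℕ.+ n))
    denom-nonZero {δ} δ≤1 n = ℕ.>-nonZero (ℕP.≤-trans (s≤s z≤n) (ℕP.∸-mono {4} (ℕP.*-mono-≤ two≤ two≤) δ≤1))
      where two≤ = ℕP.≤-trans (s≤s (s≤s z≤n)) (n≤B (2 ℕ.+ n))

    floorVal-nonZero : ∀ {δ} → δ ℕ.≤ 1 → ∀ n → NonZero (floorVal δ (2 ℕ.+ n))
    floorVal-nonZero {δ} δ≤1 n = ℕ.>-nonZero (ℕP.≤-trans (ℕ.>-nonZero⁻¹ _ {{denom-nonZero δ≤1 n}}) (ℕP.∸-monoˡ-≤ δ (ℕP.m≤m+n _ _)))

    cross : ∀ {a b c d : ℕ} {a′ b′ c′ d′ : ℤ} → + a ≡ a′ → + b ≡ b′ → + c ≡ c′ → + d ≡ d′ →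
      (a′ + b′) * (c′ * d′) ℤ.< (c′ + d′) * (a′ * b′) → (+ a + + b) * (+ c * + d) ℤ.< (+ c + + d) * (+ a * + b)
    cross refl refl refl refl lt = lt

  module PairAlgebra (x y : ℤ) (cassini : y * y + x * x - + 6 * x * y ≡ + 1)
    {d : ℕ} (d≤1 : d ℕ.≤ 1) (f : ℕ) (outer≡ : (+ 35 * y - + 6 * x) * (+ 204 * x - + 35 * y) ≡ + f)
    (inner<outer : (+ 6 * x - y) * (+ 6 * x - y) ℤ.< y * y) where
    open WindowAlgebra x y cassini

    P A N C S δ : ℤ
    P = (+ 204 * x - + 35 * y) * (+ 204 * x - + 35 * y)
    A = (+ 6 * x - y) * (+ 6 * x - y)
    N = x * x
    C = y * y
    S = (+ 35 * y - + 6 * x) * (+ 35 * y - + 6 * x)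
    δ = + d

    private
      s p a : ℤ
      s = + 35 * y - + 6 * x
      p = + 204 * x - + 35 * y
      a = + 6 * x - y

      module G = GapIdentities P A N C S δ
        (squared s a catalan-high) (squared y p catalan-low) (squared s p catalan-outer) (squared y a catalan-inner)
        squares-inner squares-outer squares-gap

      F≡ : N - + 1225 ≡ + f
      F≡ = trans (sym catalan-outer) outer≡

      0<C-A : + 0 ℤ.< C - A
      0<C-A = subst (ℤ._< C - A) (ℤP.+-inverseʳ A) (ℤP.+-monoˡ-< (- A) inner<outer)

    upper : (A - δ + (S + C - δ)) * ((A + P - δ) * (C - δ)) ℤ.< (A + P - δ + (C - δ)) * ((A - δ) * (S + C - δ))
    upper = <-of-gap G.upper-gap 0<C-A (subst (λ F → + 0 ℤ.< gapᵁ δ F) (sym F≡) (gapᵁ-positive d≤1 f))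

    lower : (+ 1 + (A + P - δ) + (C - δ)) * ((A - δ) * (+ 1 + (S + C - δ)))
            ℤ.< (A - δ + (+ 1 + (S + C - δ))) * ((+ 1 + (A + P - δ)) * (C - δ))
    lower = <-of-gap G.lower-gap 0<C-A (subst (λ F → + 0 ℤ.< gapᴸ δ F) (sym F≡) (gapᴸ-positive d≤1 f))

  module _ {δ : ℕ} (δ≤1 : δ ℕ.≤ 1) (m : ℕ) where
    private
      outer≡ : (+ 35 * β (4 ℕ.+ m) - + 6 * β (3 ℕ.+ m)) * (+ 204 * β (3 ℕ.+ m) - + 35 * β (4 ℕ.+ m)) ≡ + (B (6 ℕ.+ m) ℕ.* B m)
      outer≡ = trans (cong₂ _*_ (sym (window-high m)) (sym (window-low m))) (sym (ℤP.pos-* (B (6 ℕ.+ m)) (B m)))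

      inner<outer : (+ 6 * β (3 ℕ.+ m) - β (4 ℕ.+ m)) * (+ 6 * β (3 ℕ.+ m) - β (4 ℕ.+ m)) ℤ.< β (4 ℕ.+ m) * β (4 ℕ.+ m)
      inner<outer = subst (λ a → a * a ℤ.< β (4 ℕ.+ m) * β (4 ℕ.+ m)) (window-mid m)
        (subst₂ ℤ._<_ (ℤP.pos-* (B (2 ℕ.+ m)) (B (2 ℕ.+ m))) (ℤP.pos-* (B (4 ℕ.+ m)) (B (4 ℕ.+ m)))
          (ℤ.+<+ (ℕP.*-mono-< B₂<B₄ B₂<B₄)))
        where B₂<B₄ = ℕP.<-trans (B-<-suc (2 ℕ.+ m)) (B-<-suc (3 ℕ.+ m))

      module PA = PairAlgebra (β (3 ℕ.+ m)) (β (4 ℕ.+ m)) (β-cassini (3 ℕ.+ m)) δ≤1 (B (6 ℕ.+ m) ℕ.* B m) outer≡ inner<outer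

      castA : + denom δ (2 ℕ.+ m) ≡ PA.A - PA.δ
      castA = trans (denom-cast δ≤1 (1 ℕ.+ m)) (cong (λ u → u * u - + δ) (window-mid m))

      castC : + denom δ (4 ℕ.+ m) ≡ PA.C - PA.δ
      castC = denom-cast δ≤1 (3 ℕ.+ m)

      castAP : + floorVal δ (2 ℕ.+ m) ≡ PA.A + PA.P - PA.δ
      castAP = trans (floorVal-cast δ≤1 m) (cong₂ (λ u v → u * u + v * v - + δ) (window-mid m) (window-low m))

      castSC : + floorVal δ (6 ℕ.+ m) ≡ PA.S + PA.C - PA.δ
      castSC = trans (floorVal-cast δ≤1 (4 ℕ.+ m)) (cong (λ u → u * u + β (4 ℕ.+ m) * β (4 ℕ.+ m) - + δ) (window-high m))

      instance
        _ = denom-nonZero δ≤1 m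
        _ = denom-nonZero δ≤1 (2 ℕ.+ m)
        _ = floorVal-nonZero δ≤1 m
        _ = floorVal-nonZero δ≤1 (4 ℕ.+ m)

    pair-upper : recip (denom δ (2 ℕ.+ m)) ℚ.+ recip (floorVal δ (6 ℕ.+ m))
                 < recip (floorVal δ (2 ℕ.+ m)) ℚ.+ recip (denom δ (4 ℕ.+ m))
    pair-upper = recip-+-< {denom δ (2 ℕ.+ m)} {floorVal δ (6 ℕ.+ m)} {floorVal δ (2 ℕ.+ m)} {denom δ (4 ℕ.+ m)}
      (cross castA castSC castAP castC PA.upper)

    pair-lower : recip (suc (floorVal δ (2 ℕ.+ m))) ℚ.+ recip (denom δ (4 ℕ.+ m))
                 < recip (denom δ (2 ℕ.+ m)) ℚ.+ recip (suc (floorVal δ (6 ℕ.+ m)))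
    pair-lower = recip-+-< {suc (floorVal δ (2 ℕ.+ m))} {denom δ (4 ℕ.+ m)} {denom δ (2 ℕ.+ m)} {suc (floorVal δ (6 ℕ.+ m))}
      (cross (one+ castAP) castC castA (one+ castSC) PA.lower)
      where
      one+ : ∀ {n z} → + n ≡ z → + suc n ≡ + 1 + z
      one+ {n} eq = trans (ℤP.pos-+ 1 n) (cong (λ u → + 1 + u) eq)

module BalancingTails where
  open import Data.Nat as ℕ using (ℕ; zero; suc; z≤n; s≤s; _∸_; _%_)
  import Data.Nat.Properties as ℕP
  open import Data.Integer using (+_; -[1+_])
  open import Data.Rational using (_<_)
  import Data.Rational as ℚ
  open import Data.Product using (_×_)
  open import Relation.Binary.PropositionalEquality
  open Balancing
  open PairInequalities
  open ReciprocalTails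

  denom-≥ : ∀ {δ} → δ ℕ.≤ 1 → ∀ {j} → 2 ℕ.≤ j → j ℕ.≤ denom δ j
  denom-≥ {δ} δ≤1 {j} 2≤j = begin
    j                   ≡⟨ ℕP.m+n∸n≡m j δ ⟨
    j ℕ.+ δ ∸ δ         ≤⟨ ℕP.∸-monoˡ-≤ δ j+δ≤B² ⟩
    B j ℕ.* B j ∸ δ     ∎
    where
    open ℕP.≤-Reasoning
    j+δ≤B² : j ℕ.+ δ ℕ.≤ B j ℕ.* B j
    j+δ≤B² = ℕP.≤-trans (ℕP.+-monoʳ-≤ j (ℕP.≤-trans δ≤1 (ℕP.≤-trans (s≤s z≤n) 2≤j)))
               (ℕP.≤-trans (ℕP.≤-reflexive (sym (trans (ℕP.*-suc j 1) (cong (j ℕ.+_) (ℕP.*-identityʳ j)))))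
                 (ℕP.*-mono-≤ (n≤B j) (ℕP.≤-trans 2≤j (n≤B j))))

  floorVal-≥ : ∀ δ j → denom δ j ℕ.≤ floorVal δ j
  floorVal-≥ δ j = ℕP.∸-monoˡ-≤ δ (ℕP.m≤m+n _ _)

  pair-lower-at : ∀ {δ} → δ ℕ.≤ 1 → ∀ {j} → 2 ℕ.≤ j →
    recip (suc (floorVal δ j)) ℚ.+ recip (denom δ (2 ℕ.+ j)) < recip (denom δ j) ℚ.+ recip (suc (floorVal δ (4 ℕ.+ j)))
  pair-lower-at δ≤1 {suc (suc m)} _ = pair-lower δ≤1 m
  pair-lower-at δ≤1 {suc zero} (s≤s ())

  pair-upper-at : ∀ {δ} → δ ℕ.≤ 1 → ∀ {j} → 2 ℕ.≤ j →
    recip (denom δ j) ℚ.+ recip (floorVal δ (4 ℕ.+ j)) < recip (floorVal δ j) ℚ.+ recip (denom δ (2 ℕ.+ j))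
  pair-upper-at δ≤1 {suc (suc m)} _ = pair-upper δ≤1 m
  pair-upper-at δ≤1 {suc zero} (s≤s ())

  module _ {δ : ℕ} (δ≤1 : δ ℕ.≤ 1) (j d c : ℕ → ℕ) (n₀ : ℕ)
    (j-step : ∀ k → n₀ ℕ.≤ k → j (suc k) ≡ 2 ℕ.+ j k)
    (2≤j : ∀ k → n₀ ℕ.≤ k → 2 ℕ.≤ j k)
    (k<j : ∀ k → n₀ ℕ.≤ k → suc k ℕ.≤ j k)
    (d≡ : ∀ k → n₀ ℕ.≤ k → d k ≡ denom δ (j k))
    (c≡ : ∀ k → n₀ ℕ.≤ k → c k ≡ floorVal δ (j k))
    where

    private
      j-step₂ : ∀ k → n₀ ℕ.≤ k → j (2 ℕ.+ k) ≡ 4 ℕ.+ j k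
      j-step₂ k n₀≤k = trans (j-step (suc k) (ℕP.m≤n⇒m≤1+n n₀≤k)) (cong (2 ℕ.+_) (j-step k n₀≤k))

      d-next : ∀ k → n₀ ℕ.≤ k → d (suc k) ≡ denom δ (2 ℕ.+ j k)
      d-next k n₀≤k = trans (d≡ (suc k) (ℕP.m≤n⇒m≤1+n n₀≤k)) (cong (denom δ) (j-step k n₀≤k))

      c-next : ∀ k → n₀ ℕ.≤ k → c (2 ℕ.+ k) ≡ floorVal δ (4 ℕ.+ j k)
      c-next k n₀≤k = trans (c≡ (2 ℕ.+ k) (ℕP.≤-trans n₀≤k (ℕP.m≤n+m k 2))) (cong (floorVal δ) (j-step₂ k n₀≤k))

      lower : ∀ k → n₀ ℕ.≤ k → recip (suc (c k)) ℚ.+ recip (d (suc k)) < recip (d k) ℚ.+ recip (suc (c (2 ℕ.+ k)))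
      lower k n₀≤k = shape (c k) (d (suc k)) (d k) (c (2 ℕ.+ k))
        (c≡ k n₀≤k) (d-next k n₀≤k) (d≡ k n₀≤k) (c-next k n₀≤k) (pair-lower-at δ≤1 {j k} (2≤j k n₀≤k))
        where
        shape : ∀ a b e f {a′ b′ e′ f′} → a ≡ a′ → b ≡ b′ → e ≡ e′ → f ≡ f′ →
          recip (suc a′) ℚ.+ recip b′ < recip e′ ℚ.+ recip (suc f′) → recip (suc a) ℚ.+ recip b < recip e ℚ.+ recip (suc f)
        shape _ _ _ _ refl refl refl refl lt = lt

      upper : ∀ k → n₀ ℕ.≤ k → recip (d k) ℚ.+ recip (c (2 ℕ.+ k)) < recip (c k) ℚ.+ recip (d (suc k))
      upper k n₀≤k = shape (d k) (c (2 ℕ.+ k)) (c k) (d (suc k))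
        (d≡ k n₀≤k) (c-next k n₀≤k) (c≡ k n₀≤k) (d-next k n₀≤k) (pair-upper-at δ≤1 {j k} (2≤j k n₀≤k))
        where
        shape : ∀ a b e f {a′ b′ e′ f′} → a ≡ a′ → b ≡ b′ → e ≡ e′ → f ≡ f′ →
          recip a′ ℚ.+ recip b′ < recip e′ ℚ.+ recip f′ → recip a ℚ.+ recip b < recip e ℚ.+ recip f
        shape _ _ _ _ refl refl refl refl lt = lt

      d-large : ∀ k → n₀ ℕ.≤ k → suc k ℕ.≤ d k
      d-large k n₀≤k = subst (suc k ℕ.≤_) (sym (d≡ k n₀≤k)) (ℕP.≤-trans (k<j k n₀≤k) (denom-≥ δ≤1 (2≤j k n₀≤k)))

      c-large : ∀ k → n₀ ℕ.≤ k → suc k ℕ.≤ c k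
      c-large k n₀≤k = subst (suc k ℕ.≤_) (sym (c≡ k n₀≤k))
        (ℕP.≤-trans (k<j k n₀≤k) (ℕP.≤-trans (denom-≥ δ≤1 (2≤j k n₀≤k)) (floorVal-≥ δ (j k))))

    floorRecip-balancing : ∀ n → n₀ ℕ.≤ n →
      (n % 2 ≡ 0 → FloorRecipLim (altTail (λ k → recip (d k)) n) (+ c n)) ×
      (n % 2 ≡ 1 → FloorRecipLim (altTail (λ k → recip (d k)) n) -[1+ c n ])
    floorRecip-balancing = floorRecip-altTail d c n₀ lower upper d-large c-large

open import Data.Nat using (ℕ; suc; z≤n; s≤s; _+_; _*_; _∸_; _%_; _≤_)
import Data.Nat.Properties as ℕP
open import Data.Nat.Tactic.RingSolver using (solve-∀)
open import Data.Integer using (+_; -[1+_]) renaming (-_ to -ℤ_; _-_ to _-ℤ_)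
import Data.Integer.Properties as ℤP
open import Data.Product using (_×_; _,_)
open import Relation.Binary.PropositionalEquality
open Balancing
open PairInequalities using (denom; floorVal)
open BalancingTails

private
  2*suc : ∀ k → 2 * suc k ≡ 2 + 2 * k
  2*suc k = ℕP.*-suc 2 k

  2*suc∸1 : ∀ k → 2 * suc k ∸ 1 ≡ suc (2 * k)
  2*suc∸1 k = cong (_∸ 1) (2*suc k)

  1≤B² : ∀ {j} → 1 ≤ j → 1 ≤ B j * B j
  1≤B² {j} 1≤j = ℕP.*-mono-≤ (ℕP.≤-trans 1≤j (n≤B j)) (ℕP.≤-trans 1≤j (n≤B j))

  2≤2*k : ∀ k → 1 ≤ k → 2 ≤ 2 * k
  2≤2*k k 1≤k = ℕP.*-monoʳ-≤ 2 1≤k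

  1+k≤2*k : ∀ k → 1 ≤ k → suc k ≤ 2 * k
  1+k≤2*k (suc k) _ = subst (suc (suc k) ≤_) (sym (2*suc k)) (s≤s (s≤s (ℕP.m≤n*m k 2)))

  2*suc+1 : ∀ k → 2 * suc k + 1 ≡ 2 + (2 * k + 1)
  2*suc+1 = solve-∀

  -[1+]-as-neg : ∀ x → -[1+ x ] ≡ -ℤ (+ (x + 1))
  -[1+]-as-neg x = cong (λ z → -ℤ (+ z)) (ℕP.+-comm 1 x)

  pred-as-sub : ∀ {x} → 1 ≤ x → + (x ∸ 1) ≡ + x -ℤ + 1
  pred-as-sub {x} 1≤x = sym (trans (ℤP.m-n≡m⊖n x 1) (ℤP.⊖-≥ 1≤x))

  -[1+pred] : ∀ {x} → 1 ≤ x → -[1+ x ∸ 1 ] ≡ -ℤ (+ x)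
  -[1+pred] {suc x} _ = refl

floor-even-squares : ∀ (n : ℕ) → 1 ≤ n →
    (n % 2 ≡ 0 → FloorRecipLim (altTail t₁ n) (+ (B (2 * n) * B (2 * n) + B (2 * n ∸ 2) * B (2 * n ∸ 2))))
    × (n % 2 ≡ 1 → FloorRecipLim (altTail t₁ n) (-ℤ (+ (B (2 * n) * B (2 * n) + B (2 * n ∸ 2) * B (2 * n ∸ 2) + 1))))
floor-even-squares n 1≤n =
  let (even , odd) = floorRecip-balancing z≤n (λ k → 2 * k) (λ k → B (2 * k) * B (2 * k))
                       (λ k → B (2 * k) * B (2 * k) + B (2 * k ∸ 2) * B (2 * k ∸ 2)) 1
                       (λ k _ → 2*suc k) 2≤2*k 1+k≤2*k (λ _ _ → refl) (λ _ _ → refl) n 1≤n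
  in even , λ p → subst (FloorRecipLim (altTail t₁ n)) (-[1+]-as-neg _) (odd p)

floor-odd-squares : ∀ (n : ℕ) → 2 ≤ n →
    (n % 2 ≡ 0 → FloorRecipLim (altTail t₂ n) (+ (B (2 * n ∸ 1) * B (2 * n ∸ 1) + B (2 * n ∸ 3) * B (2 * n ∸ 3))))
    × (n % 2 ≡ 1 → FloorRecipLim (altTail t₂ n) (-ℤ (+ (B (2 * n ∸ 1) * B (2 * n ∸ 1) + B (2 * n ∸ 3) * B (2 * n ∸ 3) + 1))))
floor-odd-squares n 2≤n =
  let (even , odd) = floorRecip-balancing z≤n (λ k → 2 * k ∸ 1) (λ k → B (2 * k ∸ 1) * B (2 * k ∸ 1))
                       (λ k → B (2 * k ∸ 1) * B (2 * k ∸ 1) + B (2 * k ∸ 3) * B (2 * k ∸ 3)) 2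
                       step 2≤j k<j (λ _ _ → refl) c≡ n 2≤n
  in even , λ p → subst (FloorRecipLim (altTail t₂ n)) (-[1+]-as-neg _) (odd p)
  where
  step : ∀ k → 2 ≤ k → 2 * suc k ∸ 1 ≡ 2 + (2 * k ∸ 1)
  step (suc k) _ = trans (2*suc∸1 (suc k)) (trans (cong suc (2*suc k)) (cong (λ i → 2 + i) (sym (2*suc∸1 k))))
  2≤j : ∀ k → 2 ≤ k → 2 ≤ 2 * k ∸ 1
  2≤j (suc k) (s≤s 1≤k) = subst (2 ≤_) (sym (2*suc∸1 k)) (s≤s (ℕP.≤-trans 1≤k (ℕP.m≤n*m k 2)))
  k<j : ∀ k → 2 ≤ k → suc k ≤ 2 * k ∸ 1
  k<j (suc k) (s≤s 1≤k) = subst (suc (suc k) ≤_) (sym (2*suc∸1 k)) (s≤s (1+k≤2*k k 1≤k))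
  c≡ : ∀ k → 2 ≤ k → B (2 * k ∸ 1) * B (2 * k ∸ 1) + B (2 * k ∸ 3) * B (2 * k ∸ 3) ≡ floorVal 0 (2 * k ∸ 1)
  c≡ k _ = cong (λ i → B (2 * k ∸ 1) * B (2 * k ∸ 1) + B i * B i) (sym (ℕP.∸-+-assoc (2 * k) 1 2))

floor-odd-neighbours : ∀ (n : ℕ) → 1 ≤ n →
    (n % 2 ≡ 0 → FloorRecipLim (altTail t₃ n) (+ (B (2 * n) * B (2 * n) + B (2 * n ∸ 2) * B (2 * n ∸ 2)) -ℤ + 1))
    × (n % 2 ≡ 1 → FloorRecipLim (altTail t₃ n) (-ℤ (+ (B (2 * n) * B (2 * n) + B (2 * n ∸ 2) * B (2 * n ∸ 2)))))
floor-odd-neighbours n 1≤n =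
  let (even , odd) = floorRecip-balancing (s≤s z≤n) (λ k → 2 * k) (λ k → B (2 * k ∸ 1) * B (2 * k + 1))
                       (λ k → B (2 * k) * B (2 * k) + B (2 * k ∸ 2) * B (2 * k ∸ 2) ∸ 1) 1
                       (λ k _ → 2*suc k) 2≤2*k 1+k≤2*k d≡ (λ _ _ → refl) n 1≤n
  in (λ p → subst (FloorRecipLim (altTail t₃ n)) (pred-as-sub X≥1) (even p)) ,
     (λ p → subst (FloorRecipLim (altTail t₃ n)) (-[1+pred] X≥1) (odd p))
  where
  X≥1 : 1 ≤ B (2 * n) * B (2 * n) + B (2 * n ∸ 2) * B (2 * n ∸ 2)
  X≥1 = ℕP.≤-trans (1≤B² (ℕP.≤-trans (s≤s z≤n) (2≤2*k n 1≤n))) (ℕP.m≤m+n _ _)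
  d≡ : ∀ k → 1 ≤ k → B (2 * k ∸ 1) * B (2 * k + 1) ≡ denom 1 (2 * k)
  d≡ (suc k) _ = begin
    B (2 * suc k ∸ 1) * B (2 * suc k + 1)   ≡⟨ cong₂ (λ u v → B u * B v) (2*suc∸1 k) (2*suc+1 k) ⟩
    B (suc (2 * k)) * B (2 + (2 * k + 1))   ≡⟨ cong (λ i → B (suc (2 * k)) * B (2 + i)) (ℕP.+-comm (2 * k) 1) ⟩
    B (suc (2 * k)) * B (2 + suc (2 * k))   ≡⟨ B-neighbours (suc (2 * k)) ⟩
    B (2 + 2 * k) * B (2 + 2 * k) ∸ 1       ≡⟨ cong (λ u → B u * B u ∸ 1) (sym (2*suc k)) ⟩
    B (2 * suc k) * B (2 * suc k) ∸ 1       ∎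
    where open ≡-Reasoning

floor-even-neighbours : ∀ (n : ℕ) → 1 ≤ n →
    (n % 2 ≡ 0 → FloorRecipLim (altTail t₄ n) (+ (B (2 * n + 1) * B (2 * n + 1) + B (2 * n ∸ 1) * B (2 * n ∸ 1)) -ℤ + 1))
    × (n % 2 ≡ 1 → FloorRecipLim (altTail t₄ n) (-ℤ (+ (B (2 * n + 1) * B (2 * n + 1) + B (2 * n ∸ 1) * B (2 * n ∸ 1)))))
floor-even-neighbours n 1≤n =
  let (even , odd) = floorRecip-balancing (s≤s z≤n) (λ k → 2 * k + 1) (λ k → B (2 * k) * B (2 * k + 2))
                       (λ k → B (2 * k + 1) * B (2 * k + 1) + B (2 * k ∸ 1) * B (2 * k ∸ 1) ∸ 1) 1
                       (λ k _ → 2*suc+1 k) 2≤j k<j d≡ c≡ n 1≤n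
  in (λ p → subst (FloorRecipLim (altTail t₄ n)) (pred-as-sub X≥1) (even p)) ,
     (λ p → subst (FloorRecipLim (altTail t₄ n)) (-[1+pred] X≥1) (odd p))
  where
  X≥1 : 1 ≤ B (2 * n + 1) * B (2 * n + 1) + B (2 * n ∸ 1) * B (2 * n ∸ 1)
  X≥1 = ℕP.≤-trans (1≤B² (ℕP.m≤n+m 1 (2 * n))) (ℕP.m≤m+n _ _)
  2≤j : ∀ k → 1 ≤ k → 2 ≤ 2 * k + 1
  2≤j k 1≤k = ℕP.≤-trans (2≤2*k k 1≤k) (ℕP.m≤m+n (2 * k) 1)
  k<j : ∀ k → 1 ≤ k → suc k ≤ 2 * k + 1
  k<j k 1≤k = ℕP.≤-trans (1+k≤2*k k 1≤k) (ℕP.m≤m+n (2 * k) 1)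
  d≡ : ∀ k → 1 ≤ k → B (2 * k) * B (2 * k + 2) ≡ denom 1 (2 * k + 1)
  d≡ k _ = begin
    B (2 * k) * B (2 * k + 2)               ≡⟨ cong (λ v → B (2 * k) * B v) (ℕP.+-comm (2 * k) 2) ⟩
    B (2 * k) * B (2 + 2 * k)               ≡⟨ B-neighbours (2 * k) ⟩
    B (1 + 2 * k) * B (1 + 2 * k) ∸ 1       ≡⟨ cong (λ u → B u * B u ∸ 1) (ℕP.+-comm 1 (2 * k)) ⟩
    B (2 * k + 1) * B (2 * k + 1) ∸ 1       ∎
    where open ≡-Reasoning
  c≡ : ∀ k → 1 ≤ k → B (2 * k + 1) * B (2 * k + 1) + B (2 * k ∸ 1) * B (2 * k ∸ 1) ∸ 1 ≡ floorVal 1 (2 * k + 1)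
  c≡ k _ = cong (λ i → B (2 * k + 1) * B (2 * k + 1) + B i * B i ∸ 1)
             (trans (cong (_∸ 1) (sym (ℕP.m+n∸n≡m (2 * k) 1))) (ℕP.∸-+-assoc (2 * k + 1) 1 1))

theorem10 : (∀ (n : ℕ) → 1 ≤ n →
    (n % 2 ≡ 0 → FloorRecipLim (altTail t₁ n) (+ (B (2 * n) * B (2 * n) + B (2 * n ∸ 2) * B (2 * n ∸ 2))))
    × (n % 2 ≡ 1 → FloorRecipLim (altTail t₁ n) (-ℤ (+ (B (2 * n) * B (2 * n) + B (2 * n ∸ 2) * B (2 * n ∸ 2) + 1)))))
  × (∀ (n : ℕ) → 2 ≤ n →
    (n % 2 ≡ 0 → FloorRecipLim (altTail t₂ n) (+ (B (2 * n ∸ 1) * B (2 * n ∸ 1) + B (2 * n ∸ 3) * B (2 * n ∸ 3))))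
    × (n % 2 ≡ 1 → FloorRecipLim (altTail t₂ n) (-ℤ (+ (B (2 * n ∸ 1) * B (2 * n ∸ 1) + B (2 * n ∸ 3) * B (2 * n ∸ 3) + 1)))))
  × (∀ (n : ℕ) → 1 ≤ n →
    (n % 2 ≡ 0 → FloorRecipLim (altTail t₃ n) (+ (B (2 * n) * B (2 * n) + B (2 * n ∸ 2) * B (2 * n ∸ 2)) -ℤ + 1))
    × (n % 2 ≡ 1 → FloorRecipLim (altTail t₃ n) (-ℤ (+ (B (2 * n) * B (2 * n) + B (2 * n ∸ 2) * B (2 * n ∸ 2))))))
  × (∀ (n : ℕ) → 1 ≤ n →
    (n % 2 ≡ 0 → FloorRecipLim (altTail t₄ n) (+ (B (2 * n + 1) * B (2 * n + 1) + B (2 * n ∸ 1) * B (2 * n ∸ 1)) -ℤ + 1))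
    × (n % 2 ≡ 1 → FloorRecipLim (altTail t₄ n) (-ℤ (+ (B (2 * n + 1) * B (2 * n + 1) + B (2 * n ∸ 1) * B (2 * n ∸ 1))))))
theorem10 = floor-even-squares , floor-odd-squares , floor-odd-neighbours , floor-even-neighbours
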